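{- Let $(T,S^2)$ be a dessin d'enfant on the sphere whose underlying graph $T$ is a tree, with edge set $\mathcal E$ and monodromy pair $(\sigma_\circ,\sigma_\bullet)$. Then for every $s\in S_{\mathcal E}$, the pair $(\sigma_\circ^s,\sigma_\bullet)$ is transitive if and only if $z(\sigma_\circ^s\sigma_\bullet)=1$.
   Context: Permutations compose functionally, $\pi^s=s\pi s^{ -1}$, $z(\pi)$ is the number of $\pi$-orbits (fixed points included), and a pair is transitive iff the subgroup it generates acts transitively. A dessin d'enfant is a finite bicolored graph (each vertex white or black, every vertex incident to an edge, every edge joins a white and a black vertex) embedded in a connected oriented compact surface without boundary with complement a disjoint union of open discs. Its monodromy pair: $\sigma_\circ$ (resp. $\sigma_\bullet$) sends each edge to the next edge around its white (resp. black) vertex in the cyclic order given by the orientation of the surface. -}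

module Defs where

open import Data.Nat using (ℕ; _+_)
open import Data.Nat as ℕ using (zero; suc)
open import Data.Fin using (Fin; toℕ; zero; suc) renaming (_≤_ to _≤ᶠ_)
open import Data.Fin.Properties using (all?) renaming (_≤?_ to _≤ᶠ?_)
open import Data.Fin.Permutation using (Permutation′; _⟨$⟩ʳ_; _⟨$⟩ˡ_; _∘ₚ_; flip)
open import Data.List using (List; length; filter)
open import Data.List.Base using (allFin)
open import Data.Product using (Σ; ∃; _×_; _,_)
open import Relation.Binary.PropositionalEquality using (_≡_; _≢_)
open import Relation.Nullary using (¬_)
open import Relation.Unary using (Decidable)

Perm : ℕ → Set
Perm n = Permutation′ n

-- Functional composition: (π · ρ) x = π (ρ x).
_·_ : ∀ {n} → Perm n → Perm n → Perm n
π · ρ = ρ ∘ₚ π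

_^_ : ∀ {n} → Perm n → Perm n → Perm n
π ^ s = s · (π · flip s)

iter : ∀ {n} → Perm n → ℕ → Fin n → Fin n
iter π zero    x = x
iter π (suc k) x = π ⟨$⟩ʳ iter π k x

-- x is the least element (in the order of Fin n) of its π-orbit
-- (an orbit of a permutation of an n-element set is {π^k x | k < n}).
IsOrbitMin : ∀ {n} → Perm n → Fin n → Set
IsOrbitMin {n} π x = ∀ (k : Fin n) → x ≤ᶠ iter π (toℕ k) x

isOrbitMin? : ∀ {n} (π : Perm n) → Decidable (IsOrbitMin π)
isOrbitMin? π x = all? (λ k → x ≤ᶠ? iter π (toℕ k) x)

-- z(π): number of π-orbits (fixed points included), counted by their
-- least elements.
z : ∀ {n} → Perm n → ℕ
z {n} π = length (filter (isOrbitMin? π) (allFin n))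

data Reach {n} (α β : Perm n) : Fin n → Fin n → Set where
  here  : ∀ {x} → Reach α β x x
  stepα  : ∀ {x y} → Reach α β x y → Reach α β x (α ⟨$⟩ʳ y)
  stepα⁻ : ∀ {x y} → Reach α β x y → Reach α β x (α ⟨$⟩ˡ y)
  stepβ  : ∀ {x y} → Reach α β x y → Reach α β x (β ⟨$⟩ʳ y)
  stepβ⁻ : ∀ {x y} → Reach α β x y → Reach α β x (β ⟨$⟩ˡ y)

Transitive : ∀ {n} → Perm n → Perm n → Set
Transitive {n} α β = ∀ (x y : Fin n) → Reach α β x y

-- The underlying bipartite graph of the dessin with monodromy (σ∘, σ•)
-- on edge set Fin n: white vertices = σ∘-orbits, black vertices =
-- σ•-orbits, edge e joins the σ∘-orbit of e to the σ•-orbit of e.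

SameVertex : ∀ {n} → Perm n → Fin n → Fin n → Set
SameVertex π e e' = ∃ λ k → iter π k e ≡ e'

-- Graph connectivity (in terms of edges: every vertex carries an edge,
-- so the graph is connected iff any two edges are joined by a chain of
-- edges, consecutive ones sharing a vertex), and the graph is nonempty.
data Linked {n} (w b : Perm n) : Fin n → Fin n → Set where
  here   : ∀ {e} → Linked w b e e
  viaW   : ∀ {e e' e''} → Linked w b e e' → SameVertex w e' e'' → Linked w b e e''
  viaB   : ∀ {e e' e''} → Linked w b e e' → SameVertex b e' e'' → Linked w b e e''

Connected : ∀ {n} → Perm n → Perm n → Set
Connected {n} w b = Fin n × (∀ (e e' : Fin n) → Linked w b e e')

-- successor modulo k+1 on Fin (k+1)
next : ∀ {k} → Fin (suc k) → Fin (suc k)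
next {zero}  zero = zero
next {suc k} zero = suc zero
next {suc k} (suc i) with next {k} i
... | zero  = zero
... | suc j = suc (suc j)

-- A cycle in the bipartite multigraph, presented as a closed trail of
-- positive length (a graph has a cycle iff it has such a closed trail):
-- pairwise distinct edges a₀ b₀ a₁ b₁ … a_k b_k (k+1 ≥ 1 pairs), with aᵢ, bᵢ
-- sharing a white vertex and bᵢ, a_{i+1 mod k+1} sharing a black vertex.
record Cycle {n} (w b : Perm n) : Set where
  field
    len   : ℕ
    a     : Fin (suc len) → Fin n
    c     : Fin (suc len) → Fin n
    a-inj : ∀ i j → a i ≡ a j → i ≡ j
    c-inj : ∀ i j → c i ≡ c j → i ≡ j
    a≢c   : ∀ i j → a i ≢ c j
    white : ∀ i → SameVertex w (a i) (c i)
    black : ∀ i → SameVertex b (c i) (a (next i))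

IsTree : ∀ {n} → Perm n → Perm n → Set
IsTree w b = Connected w b × ¬ Cycle w b

-- A dessin with monodromy pair (w, b) lies on the sphere: Euler
-- characteristic V − E + F = 2 with V = z(w) + z(b), E = n, F = z(w b).
OnSphere : ∀ {n} → Perm n → Perm n → Set
OnSphere {n} w b = z w + z b + z (w · b) ≡ n + 2

TreeDessinPair : ∀ {n} → Perm n → Perm n → Set
TreeDessinPair w b = Transitive w b × OnSphere w b × IsTree w b

-- For permutations α, β of n edges whose group ⟨α, β⟩ has c orbits, two classical inequalities
-- hold: z α + z β + z (α β) ≤ n + 2c (every component of the dessin has genus ≥ 0), and
-- n + c ≤ z α + z β when the underlying bipartite graph is a forest (V ≥ E + c).  Both follow
-- by induction on n − z α: replacing α by (x αx) α splits x off its α-cycle, which raises z α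
-- by one and changes z (α β) and c by at most one, in compatible directions; for a forest c must
-- grow, since otherwise a shortest walk between the two new white vertices closes up to a cycle.
-- As z is invariant under conjugation, a transitive pair (σ∘^s, σ•) satisfies
-- n + 1 + z (σ∘^s σ•) ≤ z σ∘ + z σ• + z (σ∘^s σ•) ≤ n + 2, so σ∘^s σ• is a single cycle;
-- conversely, if σ∘^s σ• is a single cycle it alone already acts transitively.

module Submission where

open import Data.Empty using (⊥; ⊥-elim)
open import Data.Fin as Fin using (Fin; zero; suc; toℕ; fromℕ<)
import Data.Fin.Properties as Finₚ
open import Data.Fin.Permutation using (_⟨$⟩ʳ_; _⟨$⟩ˡ_; inverseˡ; inverseʳ; transpose)
import Data.Fin.Permutation.Components as PC
open import Data.List using (length; filter; tabulate)
open import Data.List.Base using (allFin)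
open import Data.Nat as ℕ using (ℕ; zero; suc; _+_; _*_; _∸_; _≤_; _<_; z≤n; s≤s; _%_; _/_)
import Data.Nat.Properties as ℕₚ
open import Data.Nat.DivMod using (m≡m%n+[m/n]*n; m%n<n)
open import Data.Nat.Induction using (<-rec; <-wellFounded)
open import Data.Product using (∃; _×_; _,_; proj₁; proj₂)
open import Data.Sum using (_⊎_; inj₁; inj₂)
open import Function using (_∘_; _∘₂_)
open import Function.Bundles using (_⇔_; mk⇔)
open import Induction.WellFounded using (module All)
import Relation.Binary.Construct.On as On
open import Relation.Binary.Definitions using (tri<; tri≈; tri>)
open import Relation.Binary.PropositionalEquality
  using (_≡_; _≢_; refl; sym; trans; cong; cong₂; subst; subst₂; module ≡-Reasoning)
open import Relation.Binary.Structures using (IsEquivalence; IsDecEquivalence)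
open import Relation.Nullary using (¬_; Dec; yes; no; ¬?; _×-dec_; _⊎-dec_; _→-dec_)
open import Relation.Nullary.Decidable using (map′; decidable-stable)
open import Relation.Unary using (Decidable; _⊆_; ∅; Empty)

open import Defs

-- Counting the elements of decidable subsets of Fin n

count : ∀ {n} {P : Fin n → Set} → Decidable P → ℕ
count {zero}  P? = 0
count {suc n} P? with P? zero
... | yes _ = suc (count (P? ∘ suc))
... | no  _ = count (P? ∘ suc)

count-≤ : ∀ {n} {P : Fin n → Set} (P? : Decidable P) → count P? ≤ n
count-≤ {zero}  P? = z≤n
count-≤ {suc n} P? with P? zero
... | yes _ = s≤s (count-≤ (P? ∘ suc))
... | no  _ = ℕₚ.m≤n⇒m≤1+n (count-≤ (P? ∘ suc))

count-pos : ∀ {n} {P : Fin n → Set} (P? : Decidable P) {x} → P x → 0 < count P?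
count-pos {suc n} P? {x} px with P? zero | x
... | yes _  | _      = s≤s z≤n
... | no ¬p₀ | zero   = ⊥-elim (¬p₀ px)
... | no _   | suc _  = count-pos (P? ∘ suc) px

count-empty : ∀ {n} {P : Fin n → Set} (P? : Decidable P) → Empty P → count P? ≡ 0
count-empty {zero}  P? ¬P = refl
count-empty {suc n} P? ¬P with P? zero
... | yes p₀ = ⊥-elim (¬P zero p₀)
... | no _   = count-empty (P? ∘ suc) (¬P ∘ suc)

count-all : ∀ {n} {P : Fin n → Set} (P? : Decidable P) → (∀ x → P x) → count P? ≡ n
count-all {zero}  P? all = refl
count-all {suc n} P? all with P? zero
... | yes _  = cong suc (count-all (P? ∘ suc) (all ∘ suc))
... | no ¬p₀ = ⊥-elim (¬p₀ (all zero))

count-mono : ∀ {n} {P Q : Fin n → Set} (P? : Decidable P) (Q? : Decidable Q) →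
             P ⊆ Q → count P? ≤ count Q?
count-mono {zero}  P? Q? P⊆Q = z≤n
count-mono {suc n} P? Q? P⊆Q with P? zero | Q? zero
... | yes p₀ | no ¬q₀ = ⊥-elim (¬q₀ (P⊆Q p₀))
... | yes _  | yes _  = s≤s (count-mono (P? ∘ suc) (Q? ∘ suc) P⊆Q)
... | no _   | yes _  = ℕₚ.m≤n⇒m≤1+n (count-mono (P? ∘ suc) (Q? ∘ suc) P⊆Q)
... | no _   | no _   = count-mono (P? ∘ suc) (Q? ∘ suc) P⊆Q

count-cong : ∀ {n} {P Q : Fin n → Set} (P? : Decidable P) (Q? : Decidable Q) →
             P ⊆ Q → Q ⊆ P → count P? ≡ count Q?
count-cong P? Q? P⊆Q Q⊆P = ℕₚ.≤-antisym (count-mono P? Q? P⊆Q) (count-mono Q? P? Q⊆P)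

count-mono-< : ∀ {n} {P Q : Fin n → Set} (P? : Decidable P) (Q? : Decidable Q) →
               P ⊆ Q → ∀ {m} → Q m → ¬ P m → count P? < count Q?
count-mono-< {suc n} P? Q? P⊆Q {m} qm ¬pm with P? zero | Q? zero | m
... | yes p₀ | no ¬q₀ | _     = ⊥-elim (¬q₀ (P⊆Q p₀))
... | yes p₀ | _      | zero  = ⊥-elim (¬pm p₀)
... | no _   | no ¬q₀ | zero  = ⊥-elim (¬q₀ qm)
... | no _   | yes _  | zero  = s≤s (count-mono (P? ∘ suc) (Q? ∘ suc) P⊆Q)
... | yes _  | yes _  | suc _ = s≤s (count-mono-< (P? ∘ suc) (Q? ∘ suc) P⊆Q qm ¬pm)
... | no _   | yes _  | suc _ = ℕₚ.m≤n⇒m≤1+n (count-mono-< (P? ∘ suc) (Q? ∘ suc) P⊆Q qm ¬pm)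
... | no _   | no _   | suc _ = count-mono-< (P? ∘ suc) (Q? ∘ suc) P⊆Q qm ¬pm

count-suc : ∀ {n} {P Q : Fin n → Set} (P? : Decidable P) (Q? : Decidable Q) →
            P ⊆ Q → ∀ {m} → Q m → ¬ P m → (∀ {u} → Q u → ¬ P u → u ≡ m) →
            count Q? ≡ suc (count P?)
count-suc {suc n} {P} {Q} P? Q? P⊆Q {m} qm ¬pm only-m with P? zero | Q? zero | m
... | yes p₀ | no ¬q₀ | _     = ⊥-elim (¬q₀ (P⊆Q p₀))
... | yes p₀ | _      | zero  = ⊥-elim (¬pm p₀)
... | no _   | no ¬q₀ | zero  = ⊥-elim (¬q₀ qm)
... | no _   | yes _  | zero  = cong suc (count-cong (Q? ∘ suc) (P? ∘ suc) Q⊆P P⊆Q)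
  where
    Q⊆P : (Q ∘ suc) ⊆ (P ∘ suc)
    Q⊆P {u} qu with P? (suc u)
    ... | yes pu = pu
    ... | no ¬pu = ⊥-elim (Finₚ.0≢1+n (sym (only-m qu ¬pu)))
... | yes _  | yes _  | suc _ =
  cong suc (count-suc (P? ∘ suc) (Q? ∘ suc) P⊆Q qm ¬pm (Finₚ.suc-injective ∘₂ only-m))
... | no ¬p₀ | yes q₀ | suc _ = ⊥-elim (Finₚ.0≢1+n (only-m q₀ ¬p₀))
... | no _   | no _   | suc _ = count-suc (P? ∘ suc) (Q? ∘ suc) P⊆Q qm ¬pm (Finₚ.suc-injective ∘₂ only-m)

∅? : ∀ {n} → Decidable {A = Fin n} ∅
∅? _ = no λ ()

count≡1 : ∀ {n} {P : Fin n → Set} (P? : Decidable P) {a} → P a → (∀ {u} → P u → u ≡ a) → count P? ≡ 1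
count≡1 {n} P? pa only-a =
  trans (count-suc ∅? P? (λ ()) pa (λ ()) (λ pu _ → only-a pu)) (cong suc (count-empty (∅? {n}) (λ _ ())))

count≡1⇒unique : ∀ {n} {P : Fin n → Set} (P? : Decidable P) → count P? ≡ 1 →
                 ∀ {a b} → P a → P b → a ≡ b
count≡1⇒unique P? count≡1 {a} {b} pa pb with a Fin.≟ b
... | yes a≡b = a≡b
... | no a≢b  = ⊥-elim (ℕₚ.<-irrefl (sym count≡1) (ℕₚ.≤-trans (s≤s first) second))
  where
    first : 0 < count (Fin._≟ a)
    first = count-pos (Fin._≟ a) refl
    second : count (Fin._≟ a) < count P?
    second = count-mono-< (Fin._≟ a) P? (λ { refl → pa }) pb (a≢b ∘ sym)

count-≤-injection : ∀ {n m} {P : Fin n → Set} {Q : Fin m → Set} (P? : Decidable P) (Q? : Decidable Q)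
                    (f : Fin n → Fin m) → (∀ {x} → P x → Q (f x)) →
                    (∀ {x y} → P x → P y → f x ≡ f y → x ≡ y) → count P? ≤ count Q?
count-≤-injection {zero}  P? Q? f f-into f-inj = z≤n
count-≤-injection {suc n} {m} {P} {Q} P? Q? f f-into f-inj with P? zero
... | no _ = count-≤-injection (P? ∘ suc) Q? (f ∘ suc) f-into
               (λ px py → Finₚ.suc-injective ∘ f-inj px py)
... | yes p₀ = begin
  suc (count (P? ∘ suc)) ≤⟨ s≤s (count-≤-injection (P? ∘ suc) Q-t? (f ∘ suc)
                               (λ px → f-into px , 0≢1+n ∘ f-inj p₀ px ∘ sym)
                               (λ px py → Finₚ.suc-injective ∘ f-inj px py)) ⟩
  suc (count Q-t?)       ≡⟨ count-suc Q-t? Q? proj₁ (f-into p₀) (λ q → proj₂ q refl) only-t ⟨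
  count Q?               ∎
  where
    open ℕₚ.≤-Reasoning
    open Finₚ using (0≢1+n)
    t : Fin m
    t = f zero
    Q-t? : Decidable (λ v → Q v × v ≢ t)
    Q-t? v = Q? v ×-dec ¬? (v Fin.≟ t)
    only-t : ∀ {u} → Q u → ¬ (Q u × u ≢ t) → u ≡ t
    only-t {u} qu ¬q-t with u Fin.≟ t
    ... | yes u≡t = u≡t
    ... | no u≢t  = ⊥-elim (¬q-t (qu , u≢t))

least-ℕ : ∀ {P : ℕ → Set} → Decidable P → ∀ {k} → P k → ∃ λ m → P m × (∀ {j} → j < m → ¬ P j)
least-ℕ {P} P? {k} = <-rec (λ k → P k → ∃ λ m → P m × (∀ {j} → j < m → ¬ P j)) search k
  where
    search : ∀ k → (∀ {j} → j < k → P j → ∃ λ m → P m × (∀ {i} → i < m → ¬ P i)) →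
             P k → ∃ λ m → P m × (∀ {j} → j < m → ¬ P j)
    search k below pk with ℕₚ.anyUpTo? P? k
    ... | yes (j , j<k , pj) = below j<k pj
    ... | no none            = k , pk , λ j<k pj → none (_ , j<k , pj)

least-Fin : ∀ {n} {P : Fin n → Set} → Decidable P → ∀ {x} → P x → ∃ λ m → P m × (∀ {y} → P y → m Fin.≤ y)
least-Fin {suc n} P? {x} px with P? zero | x
... | yes p₀ | _     = zero , p₀ , λ _ → z≤n
... | no ¬p₀ | zero  = ⊥-elim (¬p₀ px)
... | no ¬p₀ | suc _ with least-Fin (P? ∘ suc) px
...   | m , pm , m-least = suc m , pm , least
  where
    least : ∀ {y} → _ → suc m Fin.≤ y
    least {zero}  p₀ = ⊥-elim (¬p₀ p₀)
    least {suc y} py = s≤s (m-least py)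

-- Classes of a decidable equivalence relation on Fin n

record DecEquivalence (n : ℕ) : Set₁ where
  field
    _≈_              : Fin n → Fin n → Set
    isDecEquivalence : IsDecEquivalence _≈_
  open IsDecEquivalence isDecEquivalence public

module _ {n} (E : DecEquivalence n) where
  open DecEquivalence E renaming (refl to ≈-refl; sym to ≈-sym; trans to ≈-trans)

  IsClassMin : Fin n → Set
  IsClassMin x = ∀ y → x ≈ y → x Fin.≤ y

  isClassMin? : Decidable IsClassMin
  isClassMin? x = Finₚ.all? λ y → (x ≟ y) →-dec (x Fin.≤? y)

  #classes : ℕ
  #classes = count isClassMin?

  classMin : ∀ x → ∃ λ m → x ≈ m × IsClassMin m
  classMin x with least-Fin (x ≟_) ≈-refl
  ... | m , x≈m , m-least = m , x≈m , λ y m≈y → m-least (≈-trans x≈m m≈y)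

  classMin-unique : ∀ {u v} → IsClassMin u → IsClassMin v → u ≈ v → u ≡ v
  classMin-unique u-min v-min u≈v = Finₚ.≤-antisym (u-min _ u≈v) (v-min _ (≈-sym u≈v))

  #classes-discrete : (∀ {x y} → x ≈ y → x ≡ y) → #classes ≡ n
  #classes-discrete discrete = count-all isClassMin? λ x y x≈y → Finₚ.≤-reflexive (discrete x≈y)

  #classes≡1 : Fin n → (∀ x y → x ≈ y) → #classes ≡ 1
  #classes≡1 x total with classMin x
  ... | a , _ , a-min = count≡1 isClassMin? a-min λ u-min → classMin-unique u-min a-min (total _ _)

  #classes≡1⇒total : #classes ≡ 1 → ∀ x y → x ≈ y
  #classes≡1⇒total one x y with classMin x | classMin y
  ... | a , x≈a , a-min | b , y≈b , b-min =
    ≈-trans x≈a (≈-trans (≈-reflexive (count≡1⇒unique isClassMin? one a-min b-min)) (≈-sym y≈b))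
    where open DecEquivalence E using () renaming (reflexive to ≈-reflexive)

module _ {n m} (E : DecEquivalence n) (F : DecEquivalence m) where
  private
    module E = DecEquivalence E
    module F = DecEquivalence F

  #classes-≤ : (f : Fin n → Fin m) → (∀ {x y} → f x F.≈ f y → x E.≈ y) → #classes E ≤ #classes F
  #classes-≤ f reflects =
    count-≤-injection (isClassMin? E) (isClassMin? F) (proj₁ ∘ min-f) (λ {x} _ → proj₂ (proj₂ (min-f x))) inj
    where
      min-f : ∀ x → ∃ λ m → f x F.≈ m × IsClassMin F m
      min-f x = classMin F (f x)
      inj : ∀ {x y} → IsClassMin E x → IsClassMin E y → proj₁ (min-f x) ≡ proj₁ (min-f y) → x ≡ y
      inj {x} {y} x-min y-min same = classMin-unique E x-min y-min (reflects
        (F.trans (proj₁ (proj₂ (min-f x))) (subst (F._≈ f y) (sym same) (F.sym (proj₁ (proj₂ (min-f y)))))))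

module _ {n} (E F : DecEquivalence n) where
  private
    module E = DecEquivalence E
    module F = DecEquivalence F

  #classes-cong : (∀ {x y} → x E.≈ y → x F.≈ y) → (∀ {x y} → x F.≈ y → x E.≈ y) → #classes E ≡ #classes F
  #classes-cong E⊆F F⊆E =
    count-cong (isClassMin? E) (isClassMin? F) (λ min y x≈y → min y (F⊆E x≈y)) (λ min y x≈y → min y (E⊆F x≈y))

module _ {n} (E : DecEquivalence n) (x y : Fin n) where
  open DecEquivalence E renaming (refl to ≈-refl; sym to ≈-sym; trans to ≈-trans)

  Glued : Fin n → Fin n → Set
  Glued u v = u ≈ v ⊎ (u ≈ x × v ≈ y) ⊎ (u ≈ y × v ≈ x)

  Glued-refl : ∀ {u} → Glued u u
  Glued-refl = inj₁ ≈-refl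

  Glued-sym : ∀ {u v} → Glued u v → Glued v u
  Glued-sym (inj₁ u≈v)               = inj₁ (≈-sym u≈v)
  Glued-sym (inj₂ (inj₁ (u≈x , v≈y))) = inj₂ (inj₂ (v≈y , u≈x))
  Glued-sym (inj₂ (inj₂ (u≈y , v≈x))) = inj₂ (inj₁ (v≈x , u≈y))

  Glued-trans : ∀ {u v w} → Glued u v → Glued v w → Glued u w
  Glued-trans (inj₁ u≈v)               (inj₁ v≈w)               = inj₁ (≈-trans u≈v v≈w)
  Glued-trans (inj₁ u≈v)               (inj₂ (inj₁ (v≈x , w≈y))) = inj₂ (inj₁ (≈-trans u≈v v≈x , w≈y))
  Glued-trans (inj₁ u≈v)               (inj₂ (inj₂ (v≈y , w≈x))) = inj₂ (inj₂ (≈-trans u≈v v≈y , w≈x))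
  Glued-trans (inj₂ (inj₁ (u≈x , v≈y))) (inj₁ v≈w)               = inj₂ (inj₁ (u≈x , ≈-trans (≈-sym v≈w) v≈y))
  Glued-trans (inj₂ (inj₁ (u≈x , _)))   (inj₂ (inj₁ (_ , w≈y)))  = inj₂ (inj₁ (u≈x , w≈y))
  Glued-trans (inj₂ (inj₁ (u≈x , _)))   (inj₂ (inj₂ (_ , w≈x)))  = inj₁ (≈-trans u≈x (≈-sym w≈x))
  Glued-trans (inj₂ (inj₂ (u≈y , v≈x))) (inj₁ v≈w)               = inj₂ (inj₂ (u≈y , ≈-trans (≈-sym v≈w) v≈x))
  Glued-trans (inj₂ (inj₂ (u≈y , _)))   (inj₂ (inj₁ (_ , w≈y)))  = inj₁ (≈-trans u≈y (≈-sym w≈y))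
  Glued-trans (inj₂ (inj₂ (u≈y , _)))   (inj₂ (inj₂ (_ , w≈x)))  = inj₂ (inj₂ (u≈y , w≈x))

  Glued⇒≈ : x ≈ y → ∀ {u v} → Glued u v → u ≈ v
  Glued⇒≈ x≈y (inj₁ u≈v)               = u≈v
  Glued⇒≈ x≈y (inj₂ (inj₁ (u≈x , v≈y))) = ≈-trans u≈x (≈-trans x≈y (≈-sym v≈y))
  Glued⇒≈ x≈y (inj₂ (inj₂ (u≈y , v≈x))) = ≈-trans u≈y (≈-trans (≈-sym x≈y) (≈-sym v≈x))

Glued-isEquivalence : ∀ {n} (E : DecEquivalence n) x y → IsEquivalence (Glued E x y)
Glued-isEquivalence E x y = record { refl = Glued-refl E x y ; sym = Glued-sym E x y ; trans = Glued-trans E x y }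

Glued-comm : ∀ {n} (E : DecEquivalence n) {x y u v} → Glued E x y u v → Glued E y x u v
Glued-comm E (inj₁ u≈v)      = inj₁ u≈v
Glued-comm E (inj₂ (inj₁ p)) = inj₂ (inj₂ p)
Glued-comm E (inj₂ (inj₂ p)) = inj₂ (inj₁ p)

module _ {n} (S R : DecEquivalence n) (S⊆R : ∀ {u v} → DecEquivalence._≈_ S u v → DecEquivalence._≈_ R u v) where
  private
    module S = DecEquivalence S
    module R = DecEquivalence R

    -- Gluing the classes with minima a ≤ b removes exactly b from the set of class minima.
    glue-ordered : ∀ {x y a b} → (∀ {u v} → u R.≈ v → Glued S x y u v) → ¬ x S.≈ y → x R.≈ y →
                   x S.≈ a → IsClassMin S a → y S.≈ b → IsClassMin S b → a Fin.≤ b →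
                   #classes S ≡ suc (#classes R)
    glue-ordered {x} {y} {a} {b} R⊆Glued x≉y x≈y x≈a a-min y≈b b-min a≤b =
      count-suc (isClassMin? R) (isClassMin? S) R-min⇒S-min b-min b-not-R-min only-b
      where
        R-min⇒S-min : ∀ {u} → IsClassMin R u → IsClassMin S u
        R-min⇒S-min u-min v u≈v = u-min v (S⊆R u≈v)

        b-not-R-min : ¬ IsClassMin R b
        b-not-R-min b-min′ = x≉y (S.trans x≈a (S.trans (S.reflexive a≡b) (S.sym y≈b)))
          where
            a≡b : a ≡ b
            a≡b = Finₚ.≤-antisym a≤b (b-min′ a (R.trans (S⊆R (S.sym y≈b)) (R.trans (R.sym x≈y) (S⊆R x≈a))))

        cover : ∀ {v} → a R.≈ v → a S.≈ v ⊎ b S.≈ v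
        cover a≈v with R⊆Glued (R.trans (S⊆R x≈a) a≈v)
        ... | inj₁ x≈v              = inj₁ (S.trans (S.sym x≈a) x≈v)
        ... | inj₂ (inj₁ (_ , v≈y)) = inj₂ (S.trans (S.sym y≈b) (S.sym v≈y))
        ... | inj₂ (inj₂ (x≈y′ , _)) = ⊥-elim (x≉y x≈y′)

        a-R-min : IsClassMin R a
        a-R-min v a≈v with cover a≈v
        ... | inj₁ a≈v′ = a-min v a≈v′
        ... | inj₂ b≈v  = Finₚ.≤-trans a≤b (b-min v b≈v)

        away : ∀ {u v} → u R.≈ v → ¬ u R.≈ a → u S.≈ v
        away u≈v u≉a with R⊆Glued u≈v
        ... | inj₁ u≈v′              = u≈v′
        ... | inj₂ (inj₁ (u≈x , _)) = ⊥-elim (u≉a (S⊆R (S.trans u≈x x≈a)))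
        ... | inj₂ (inj₂ (u≈y , _)) = ⊥-elim (u≉a (R.trans (S⊆R u≈y) (R.trans (R.sym x≈y) (S⊆R x≈a))))

        only-b : ∀ {u} → IsClassMin S u → ¬ IsClassMin R u → u ≡ b
        only-b {u} u-min u-not-R-min with u R.≟ a
        ... | no u≉a  = ⊥-elim (u-not-R-min λ v u≈v → u-min v (away u≈v u≉a))
        ... | yes u≈a with cover (R.sym u≈a)
        ...   | inj₁ a≈u = ⊥-elim (u-not-R-min (subst (IsClassMin R) (classMin-unique S a-min u-min a≈u) a-R-min))
        ...   | inj₂ b≈u = sym (classMin-unique S b-min u-min b≈u)

  module _ {x y} (R⊆Glued : ∀ {u v} → u R.≈ v → Glued S x y u v) where

    #classes-glue : ¬ x S.≈ y → x R.≈ y → #classes S ≡ suc (#classes R)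
    #classes-glue x≉y x≈y with classMin S x | classMin S y
    ... | a , x≈a , a-min | b , y≈b , b-min with a Fin.≤? b
    ...   | yes a≤b = glue-ordered R⊆Glued x≉y x≈y x≈a a-min y≈b b-min a≤b
    ...   | no a≰b  = glue-ordered (Glued-comm S ∘ R⊆Glued) (x≉y ∘ S.sym) (R.sym x≈y)
                        y≈b b-min x≈a a-min (ℕₚ.≰⇒≥ a≰b)

    #classes-glue-redundant : x S.≈ y → #classes S ≡ #classes R
    #classes-glue-redundant x≈y = #classes-cong S R S⊆R (Glued⇒≈ S x y x≈y ∘ R⊆Glued)

-- Orbits of a permutation

length-filter-allFin : ∀ {n} {P : Fin n → Set} (P? : Decidable P) → length (filter P? (allFin n)) ≡ count P?
length-filter-allFin {n} P? = go n (λ i → i)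
  where
    go : ∀ m (f : Fin m → Fin n) → length (filter P? (tabulate f)) ≡ count (P? ∘ f)
    go zero    f = refl
    go (suc m) f with P? (f zero)
    ... | yes _ = cong suc (go m (f ∘ suc))
    ... | no  _ = go m (f ∘ suc)

module _ {n} (π : Perm n) where

  iter-+ : ∀ a b x → iter π (a + b) x ≡ iter π a (iter π b x)
  iter-+ zero    b x = refl
  iter-+ (suc a) b x = cong (π ⟨$⟩ʳ_) (iter-+ a b x)

  iter-injective : ∀ k {u v} → iter π k u ≡ iter π k v → u ≡ v
  iter-injective zero    eq = eq
  iter-injective (suc k) eq = iter-injective k (trans (sym (inverseˡ π)) (trans (cong (π ⟨$⟩ˡ_) eq) (inverseˡ π)))

  period : ∀ x → ∃ λ p → p < n × iter π (suc p) x ≡ x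
  period x with Finₚ.pigeonhole (ℕₚ.n<1+n n) (λ (i : Fin (suc n)) → iter π (toℕ i) x)
  ... | i , j , i<j , πⁱx≡πʲx = p , p<n , iter-injective (toℕ i) (begin
      iter π (toℕ i) (iter π (suc p) x) ≡⟨ iter-+ (toℕ i) (suc p) x ⟨
      iter π (toℕ i + suc p) x          ≡⟨ cong (λ k → iter π k x) i+1+p≡j ⟩
      iter π (toℕ j) x                  ≡⟨ πⁱx≡πʲx ⟨
      iter π (toℕ i) x                  ∎)
    where
      open ≡-Reasoning
      p : ℕ
      p = toℕ j ∸ suc (toℕ i)
      i+1+p≡j : toℕ i + suc p ≡ toℕ j
      i+1+p≡j = trans (ℕₚ.+-suc (toℕ i) p) (ℕₚ.m+[n∸m]≡n i<j)
      p<n : p < n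
      p<n = ℕₚ.≤-trans (subst (suc p ≤_) i+1+p≡j (ℕₚ.m≤n+m (suc p) (toℕ i))) (ℕₚ.≤-pred (Finₚ.toℕ<n j))

  iter-mod-period : ∀ {p x} → iter π (suc p) x ≡ x → ∀ k → iter π k x ≡ iter π (k % suc p) x
  iter-mod-period {p} {x} πᵖ⁺¹x≡x k = begin
    iter π k x                                      ≡⟨ cong (λ m → iter π m x) (m≡m%n+[m/n]*n k (suc p)) ⟩
    iter π (k % suc p + k / suc p * suc p) x        ≡⟨ iter-+ (k % suc p) (k / suc p * suc p) x ⟩
    iter π (k % suc p) (iter π (k / suc p * suc p) x) ≡⟨ cong (iter π (k % suc p)) (iter-multiple (k / suc p)) ⟩
    iter π (k % suc p) x                            ∎
    where
      open ≡-Reasoning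
      iter-multiple : ∀ q → iter π (q * suc p) x ≡ x
      iter-multiple zero    = refl
      iter-multiple (suc q) =
        trans (iter-+ (suc p) (q * suc p) x) (trans (cong (iter π (suc p)) (iter-multiple q)) πᵖ⁺¹x≡x)

  SameVertex-bounded : ∀ {x y} → SameVertex π x y → ∃ λ k → k < n × iter π k x ≡ y
  SameVertex-bounded {x} (k , πᵏx≡y) with period x
  ... | p , p<n , πᵖ⁺¹x≡x =
    k % suc p , ℕₚ.<-≤-trans (m%n<n k (suc p)) p<n , trans (sym (iter-mod-period πᵖ⁺¹x≡x k)) πᵏx≡y

  SameVertex-refl : ∀ {x} → SameVertex π x x
  SameVertex-refl = 0 , refl

  SameVertex-trans : ∀ {x y w} → SameVertex π x y → SameVertex π y w → SameVertex π x w
  SameVertex-trans {x} (a , πᵃx≡y) (b , πᵇy≡w) = b + a , trans (iter-+ b a x) (trans (cong (iter π b) πᵃx≡y) πᵇy≡w)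

  SameVertex-sym : ∀ {x y} → SameVertex π x y → SameVertex π y x
  SameVertex-sym {x} {y} (k , πᵏx≡y) with period x
  ... | p , _ , πᵖ⁺¹x≡x = suc p ∸ r , (begin
    iter π (suc p ∸ r) y                 ≡⟨ cong (iter π (suc p ∸ r)) πʳx≡y ⟨
    iter π (suc p ∸ r) (iter π r x)      ≡⟨ iter-+ (suc p ∸ r) r x ⟨
    iter π (suc p ∸ r + r) x             ≡⟨ cong (λ m → iter π m x) (ℕₚ.m∸n+n≡m (ℕₚ.<⇒≤ (m%n<n k (suc p)))) ⟩
    iter π (suc p) x                     ≡⟨ πᵖ⁺¹x≡x ⟩
    x                                    ∎)
    where
      open ≡-Reasoning
      r : ℕ
      r = k % suc p
      πʳx≡y : iter π r x ≡ y
      πʳx≡y = trans (sym (iter-mod-period πᵖ⁺¹x≡x k)) πᵏx≡y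

  sameVertex? : ∀ x y → Dec (SameVertex π x y)
  sameVertex? x y with ℕₚ.anyUpTo? (λ k → iter π k x Fin.≟ y) n
  ... | yes (k , _ , πᵏx≡y) = yes (k , πᵏx≡y)
  ... | no none             = no λ same → none (SameVertex-bounded same)

  orbits : DecEquivalence n
  orbits = record
    { _≈_              = SameVertex π
    ; isDecEquivalence = record
      { isEquivalence = record { refl = SameVertex-refl ; sym = SameVertex-sym ; trans = SameVertex-trans }
      ; _≟_           = sameVertex?
      }
    }

  z≡#classes-orbits : z π ≡ #classes orbits
  z≡#classes-orbits = trans (length-filter-allFin (isOrbitMin? π))
    (count-cong (isOrbitMin? π) (isClassMin? orbits) orbit-min⇒class-min class-min⇒orbit-min)
    where
      orbit-min⇒class-min : ∀ {x} → IsOrbitMin π x → IsClassMin orbits x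
      orbit-min⇒class-min {x} x-min y same with SameVertex-bounded same
      ... | k , k<n , refl = subst (λ j → x Fin.≤ iter π j x) (Finₚ.toℕ-fromℕ< k<n) (x-min (fromℕ< k<n))
      class-min⇒orbit-min : ∀ {x} → IsClassMin orbits x → IsOrbitMin π x
      class-min⇒orbit-min {x} x-min k = x-min (iter π (toℕ k) x) (toℕ k , refl)

z-cong : ∀ {n} (π ρ : Perm n) → (∀ u → π ⟨$⟩ʳ u ≡ ρ ⟨$⟩ʳ u) → z π ≡ z ρ
z-cong π ρ π≗ρ = begin
  z π                  ≡⟨ z≡#classes-orbits π ⟩
  #classes (orbits π)  ≡⟨ #classes-cong (orbits π) (orbits ρ) (same-iterates π ρ π≗ρ) (same-iterates ρ π (sym ∘ π≗ρ)) ⟩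
  #classes (orbits ρ)  ≡⟨ z≡#classes-orbits ρ ⟨
  z ρ                  ∎
  where
    open ≡-Reasoning
    iter-cong : ∀ (π ρ : Perm _) → (∀ u → π ⟨$⟩ʳ u ≡ ρ ⟨$⟩ʳ u) → ∀ k u → iter π k u ≡ iter ρ k u
    iter-cong π ρ π≗ρ zero    u = refl
    iter-cong π ρ π≗ρ (suc k) u = trans (π≗ρ _) (cong (ρ ⟨$⟩ʳ_) (iter-cong π ρ π≗ρ k u))
    same-iterates : ∀ (π ρ : Perm _) → (∀ u → π ⟨$⟩ʳ u ≡ ρ ⟨$⟩ʳ u) → ∀ {u v} → SameVertex π u v → SameVertex ρ u v
    same-iterates π ρ π≗ρ {u} (k , πᵏu≡v) = k , trans (sym (iter-cong π ρ π≗ρ k u)) πᵏu≡v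

z-^ : ∀ {n} (π s : Perm n) → z (π ^ s) ≡ z π
z-^ π s = begin
  z (π ^ s)                 ≡⟨ z≡#classes-orbits (π ^ s) ⟩
  #classes (orbits (π ^ s)) ≡⟨ ℕₚ.≤-antisym (#classes-≤ (orbits (π ^ s)) (orbits π) (s ⟨$⟩ˡ_) conj⁻¹-reflects)
                                           (#classes-≤ (orbits π) (orbits (π ^ s)) (s ⟨$⟩ʳ_) conj-reflects) ⟩
  #classes (orbits π)       ≡⟨ z≡#classes-orbits π ⟨
  z π                       ∎
  where
    open ≡-Reasoning
    iter-^ : ∀ k a → iter (π ^ s) k (s ⟨$⟩ʳ a) ≡ s ⟨$⟩ʳ iter π k a
    iter-^ zero    a = refl
    iter-^ (suc k) a = trans (cong ((π ^ s) ⟨$⟩ʳ_) (iter-^ k a)) (cong (λ q → s ⟨$⟩ʳ (π ⟨$⟩ʳ q)) (inverseˡ s))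
    conj-reflects : ∀ {a b} → SameVertex (π ^ s) (s ⟨$⟩ʳ a) (s ⟨$⟩ʳ b) → SameVertex π a b
    conj-reflects {a} (k , eq) = k , iter-injective s 1 (trans (sym (iter-^ k a)) eq)
    conj⁻¹-reflects : ∀ {a b} → SameVertex π (s ⟨$⟩ˡ a) (s ⟨$⟩ˡ b) → SameVertex (π ^ s) a b
    conj⁻¹-reflects {a} {b} (k , eq) = k , (begin
      iter (π ^ s) k a                       ≡⟨ cong (iter (π ^ s) k) (inverseʳ s) ⟨
      iter (π ^ s) k (s ⟨$⟩ʳ (s ⟨$⟩ˡ a))     ≡⟨ iter-^ k (s ⟨$⟩ˡ a) ⟩
      s ⟨$⟩ʳ iter π k (s ⟨$⟩ˡ a)             ≡⟨ cong (s ⟨$⟩ʳ_) eq ⟩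
      s ⟨$⟩ʳ (s ⟨$⟩ˡ b)                      ≡⟨ inverseʳ s ⟩
      b                                      ∎)

z-≤ : ∀ {n} (π : Perm n) → z π ≤ n
z-≤ π = subst (_≤ _) (sym (z≡#classes-orbits π)) (count-≤ (isClassMin? (orbits π)))

z-pos : ∀ {n} (π : Perm n) → Fin n → 0 < z π
z-pos π x = subst (0 <_) (sym (z≡#classes-orbits π))
  (count-pos (isClassMin? (orbits π)) (proj₂ (proj₂ (classMin (orbits π) x))))

-- Composing with a transposition

module _ {n} (i j : Fin n) where

  transpose-matchˡ : PC.transpose i j i ≡ j
  transpose-matchˡ with i Fin.≟ i
  ... | yes _  = refl
  ... | no i≢i = ⊥-elim (i≢i refl)

  transpose-matchʳ : PC.transpose i j j ≡ i
  transpose-matchʳ with j Fin.≟ i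
  ... | yes j≡i = j≡i
  ... | no _ with j Fin.≟ j
  ...   | yes _  = refl
  ...   | no j≢j = ⊥-elim (j≢j refl)

  transpose-other : ∀ {k} → k ≢ i → k ≢ j → PC.transpose i j k ≡ k
  transpose-other {k} k≢i k≢j with k Fin.≟ i
  ... | yes k≡i = ⊥-elim (k≢i k≡i)
  ... | no _ with k Fin.≟ j
  ...   | yes k≡j = ⊥-elim (k≢j k≡j)
  ...   | no _    = refl

  transpose-involutive : ∀ k → PC.transpose i j (PC.transpose i j k) ≡ k
  transpose-involutive k = by-cases (k Fin.≟ i) (k Fin.≟ j)
    where
      by-cases : Dec (k ≡ i) → Dec (k ≡ j) → PC.transpose i j (PC.transpose i j k) ≡ k
      by-cases (yes refl) _          = trans (cong (PC.transpose i j) transpose-matchˡ) transpose-matchʳ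
      by-cases (no _)     (yes refl) = trans (cong (PC.transpose i j) transpose-matchʳ) transpose-matchˡ
      by-cases (no k≢i)   (no k≢j)   = trans (cong (PC.transpose i j) (transpose-other k≢i k≢j)) (transpose-other k≢i k≢j)

  Glued-transpose : ∀ (E : DecEquivalence n) u → Glued E i j u (PC.transpose i j u)
  Glued-transpose E u = by-cases (u Fin.≟ i) (u Fin.≟ j)
    where
      open DecEquivalence E using () renaming (refl to ≈-refl)
      by-cases : Dec (u ≡ i) → Dec (u ≡ j) → Glued E i j u (PC.transpose i j u)
      by-cases (yes refl) _          = subst (Glued E i j u) (sym transpose-matchˡ) (inj₂ (inj₁ (≈-refl , ≈-refl)))
      by-cases (no _)     (yes refl) = subst (Glued E i j u) (sym transpose-matchʳ) (inj₂ (inj₂ (≈-refl , ≈-refl)))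
      by-cases (no u≢i)   (no u≢j)   = subst (Glued E i j u) (sym (transpose-other u≢i u≢j)) (Glued-refl E i j)

Transposed : ∀ {n} → Fin n → Fin n → Perm n → Perm n → Set
Transposed x y ρ σ = ∀ u → σ ⟨$⟩ʳ u ≡ PC.transpose x y (ρ ⟨$⟩ʳ u)

Transposed-sym : ∀ {n} {x y : Fin n} (ρ σ : Perm n) → Transposed x y ρ σ → Transposed x y σ ρ
Transposed-sym {x = x} {y} ρ σ σ≗τρ u = trans (sym (transpose-involutive x y _)) (cong (PC.transpose x y) (sym (σ≗τρ u)))

SameVertex-Transposed⇒Glued : ∀ {n} {ρ σ : Perm n} {x y} → Transposed x y ρ σ →
                              ∀ {u v} → SameVertex σ u v → Glued (orbits ρ) x y u v
SameVertex-Transposed⇒Glued {ρ = ρ} {σ} {x} {y} σ≗τρ {u} (k , refl) = glued k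
  where
    glued : ∀ k → Glued (orbits ρ) x y u (iter σ k u)
    glued zero    = Glued-refl (orbits ρ) x y
    glued (suc k) = Glued-trans (orbits ρ) x y (glued k) (subst (Glued (orbits ρ) x y _) (sym (σ≗τρ _))
                      (Glued-trans (orbits ρ) x y (inj₁ (1 , refl)) (Glued-transpose x y (orbits ρ) _)))

module _ {n} (ρ σ : Perm n) {x y : Fin n} (x≢y : x ≢ y)
         (σ≗τρ : Transposed x y ρ σ) where

  private
    Returns : ℕ → Set
    Returns k = iter ρ (suc k) x ≡ x ⊎ iter ρ (suc k) x ≡ y

    returns? : Decidable Returns
    returns? k = (iter ρ (suc k) x Fin.≟ x) ⊎-dec (iter ρ (suc k) x Fin.≟ y)

    first-return : ∃ λ r → Returns r × (∀ {j} → j < r → ¬ Returns j)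
    first-return with period ρ x
    ... | p , _ , ρᵖ⁺¹x≡x = least-ℕ returns? {p} (inj₁ ρᵖ⁺¹x≡x)

    r : ℕ
    r = proj₁ first-return

    ρ-avoids-y : ∀ {j} → j ≤ r → iter ρ j x ≢ y
    ρ-avoids-y {zero}  _   = x≢y
    ρ-avoids-y {suc j} j<r = proj₂ (proj₂ first-return) j<r ∘ inj₂

    σ-agrees : ∀ {j} → j ≤ r → iter σ j x ≡ iter ρ j x
    σ-agrees {zero}  _   = refl
    σ-agrees {suc j} j<r = trans (cong (σ ⟨$⟩ʳ_) (σ-agrees (ℕₚ.<⇒≤ j<r)))
      (trans (σ≗τρ _) (transpose-other x y (proj₂ (proj₂ first-return) j<r ∘ inj₁) (ρ-avoids-y j<r)))

    σ-at-return : iter σ (suc r) x ≡ PC.transpose x y (iter ρ (suc r) x)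
    σ-at-return = trans (cong (σ ⟨$⟩ʳ_) (σ-agrees ℕₚ.≤-refl)) (σ≗τρ _)

    ¬SameVertex : ∀ π → iter π (suc r) x ≡ x → (∀ {j} → j ≤ r → iter π j x ≢ y) → ¬ SameVertex π x y
    ¬SameVertex π πʳ⁺¹x≡x avoids (k , πᵏx≡y) =
      avoids (ℕₚ.≤-pred (m%n<n k (suc r))) (trans (sym (iter-mod-period π πʳ⁺¹x≡x k)) πᵏx≡y)

  transpose-separates : SameVertex ρ x y → ¬ SameVertex σ x y
  transpose-separates same with proj₁ (proj₂ first-return)
  ... | inj₁ ρʳ⁺¹x≡x = ⊥-elim (¬SameVertex ρ ρʳ⁺¹x≡x ρ-avoids-y same)
  ... | inj₂ ρʳ⁺¹x≡y =
    ¬SameVertex σ (trans σ-at-return (trans (cong (PC.transpose x y) ρʳ⁺¹x≡y) (transpose-matchʳ x y)))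
                  λ j≤r σʲx≡y → ρ-avoids-y j≤r (trans (sym (σ-agrees j≤r)) σʲx≡y)

  transpose-joins : ¬ SameVertex ρ x y → SameVertex σ x y
  transpose-joins different with proj₁ (proj₂ first-return)
  ... | inj₁ ρʳ⁺¹x≡x = suc r , trans σ-at-return (trans (cong (PC.transpose x y) ρʳ⁺¹x≡x) (transpose-matchˡ x y))
  ... | inj₂ ρʳ⁺¹x≡y = ⊥-elim (different (suc r , ρʳ⁺¹x≡y))

  z-transpose-split : SameVertex ρ x y → z σ ≡ suc (z ρ)
  z-transpose-split same = begin
    z σ                          ≡⟨ z≡#classes-orbits σ ⟩
    #classes (orbits σ)          ≡⟨ #classes-glue (orbits σ) (orbits ρ)
                                      (Glued⇒≈ (orbits ρ) x y same ∘ SameVertex-Transposed⇒Glued σ≗τρ)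
                                      (SameVertex-Transposed⇒Glued (Transposed-sym ρ σ σ≗τρ))
                                      (transpose-separates same) same ⟩
    suc (#classes (orbits ρ))    ≡⟨ cong suc (z≡#classes-orbits ρ) ⟨
    suc (z ρ)                    ∎
    where open ≡-Reasoning

module _ {n} (ρ σ : Perm n) {x y : Fin n} (x≢y : x ≢ y)
         (σ≗τρ : Transposed x y ρ σ) where

  z-transpose-merge : ¬ SameVertex ρ x y → z ρ ≡ suc (z σ)
  z-transpose-merge different =
    z-transpose-split σ ρ x≢y (Transposed-sym ρ σ σ≗τρ) (transpose-joins ρ σ x≢y σ≗τρ different)

  z-transpose-≤ : z σ ≤ suc (z ρ)
  z-transpose-≤ with sameVertex? ρ x y
  ... | yes same     = ℕₚ.≤-reflexive (z-transpose-split ρ σ x≢y σ≗τρ same)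
  ... | no different = ℕₚ.≤-trans (ℕₚ.n≤1+n (z σ))
                         (ℕₚ.≤-trans (ℕₚ.≤-reflexive (sym (z-transpose-merge different))) (ℕₚ.n≤1+n (z ρ)))

-- Connected components

module _ {n} (α β : Perm n) where

  Reach-trans : ∀ {x y w} → Reach α β x y → Reach α β y w → Reach α β x w
  Reach-trans r here       = r
  Reach-trans r (stepα s)  = stepα (Reach-trans r s)
  Reach-trans r (stepα⁻ s) = stepα⁻ (Reach-trans r s)
  Reach-trans r (stepβ s)  = stepβ (Reach-trans r s)
  Reach-trans r (stepβ⁻ s) = stepβ⁻ (Reach-trans r s)

  Reach-sym : ∀ {x y} → Reach α β x y → Reach α β y x
  Reach-sym here       = here
  Reach-sym (stepα  r) = Reach-trans (subst (Reach α β _) (inverseˡ α) (stepα⁻ here)) (Reach-sym r)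
  Reach-sym (stepα⁻ r) = Reach-trans (subst (Reach α β _) (inverseʳ α) (stepα here)) (Reach-sym r)
  Reach-sym (stepβ  r) = Reach-trans (subst (Reach α β _) (inverseˡ β) (stepβ⁻ here)) (Reach-sym r)
  Reach-sym (stepβ⁻ r) = Reach-trans (subst (Reach α β _) (inverseʳ β) (stepβ here)) (Reach-sym r)

  Reach-minimal : ∀ {_∼_ : Fin n → Fin n → Set} → IsEquivalence _∼_ →
                  (∀ u → u ∼ (α ⟨$⟩ʳ u)) → (∀ u → u ∼ (β ⟨$⟩ʳ u)) → ∀ {u v} → Reach α β u v → u ∼ v
  Reach-minimal {_∼_} ∼-equiv α-step β-step = go
    where
      open IsEquivalence ∼-equiv renaming (refl to ∼-refl; sym to ∼-sym; trans to ∼-trans)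
      go : ∀ {u v} → Reach α β u v → u ∼ v
      go here               = ∼-refl
      go (stepα r)          = ∼-trans (go r) (α-step _)
      go (stepα⁻ {y = v} r) = ∼-trans (go r) (∼-sym (subst ((α ⟨$⟩ˡ v) ∼_) (inverseʳ α) (α-step _)))
      go (stepβ r)          = ∼-trans (go r) (β-step _)
      go (stepβ⁻ {y = v} r) = ∼-trans (go r) (∼-sym (subst ((β ⟨$⟩ˡ v) ∼_) (inverseʳ β) (β-step _)))

  SameVertex⇒Reachα : ∀ {u v} → SameVertex α u v → Reach α β u v
  SameVertex⇒Reachα {u} (k , refl) = go k
    where
      go : ∀ k → Reach α β u (iter α k u)
      go zero    = here
      go (suc k) = stepα (go k)

  SameVertex⇒Reachβ : ∀ {u v} → SameVertex β u v → Reach α β u v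
  SameVertex⇒Reachβ {u} (k , refl) = go k
    where
      go : ∀ k → Reach α β u (iter β k u)
      go zero    = here
      go (suc k) = stepβ (go k)

  Adjacent : Fin n → Fin n → Set
  Adjacent u v = SameVertex α u v ⊎ SameVertex β u v

  adjacent? : ∀ u v → Dec (Adjacent u v)
  adjacent? u v = sameVertex? α u v ⊎-dec sameVertex? β u v

  module _ (x : Fin n) where

    Layer : ℕ → Fin n → Set
    Layer zero    u = SameVertex α x u
    Layer (suc j) u = Layer j u ⊎ ∃ λ v → Layer j v × Adjacent v u

    layer? : ∀ j → Decidable (Layer j)
    layer? zero    u = sameVertex? α x u
    layer? (suc j) u = layer? j u ⊎-dec Finₚ.any? (λ v → layer? j v ×-dec adjacent? v u)

    Layer-mono : ∀ {i j} → i ≤ j → ∀ {u} → Layer i u → Layer j u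
    Layer-mono {j = zero}       z≤n       l                    = l
    Layer-mono {zero}  {suc j}  z≤n       l                    = inj₁ (Layer-mono z≤n l)
    Layer-mono {suc i} {suc j}  (s≤s i≤j) (inj₁ l)             = inj₁ (Layer-mono i≤j l)
    Layer-mono {suc i} {suc j}  (s≤s i≤j) (inj₂ (v , l , v∼u)) = inj₂ (v , Layer-mono i≤j l , v∼u)

    Layer⇒Reach : ∀ j {u} → Layer j u → Reach α β x u
    Layer⇒Reach zero    l                         = SameVertex⇒Reachα l
    Layer⇒Reach (suc j) (inj₁ l)                  = Layer⇒Reach j l
    Layer⇒Reach (suc j) (inj₂ (v , l , inj₁ v∼u)) = Reach-trans (Layer⇒Reach j l) (SameVertex⇒Reachα v∼u)
    Layer⇒Reach (suc j) (inj₂ (v , l , inj₂ v∼u)) = Reach-trans (Layer⇒Reach j l) (SameVertex⇒Reachβ v∼u)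

    private
      Stable : ℕ → Set
      Stable k = ∀ {u} → Layer (suc k) u → Layer k u

      stable-suc : ∀ {k} → Stable k → Stable (suc k)
      stable-suc stable (inj₁ l)             = l
      stable-suc stable (inj₂ (v , l , v∼u)) = inj₂ (v , stable l , v∼u)

      stable? : ∀ k → Dec (Stable k)
      stable? k = map′ (λ s → s _) (λ s _ → s) (Finₚ.all? λ u → layer? (suc k) u →-dec layer? k u)

      new-element : ∀ {k} → ¬ Stable k → ∃ λ u → Layer (suc k) u × ¬ Layer k u
      new-element {k} unstable with Finₚ.¬∀⟶∃¬ n _ (λ u → layer? (suc k) u →-dec layer? k u) (λ s → unstable (s _))
      ... | u , ¬step with layer? (suc k) u | layer? k u
      ...   | _      | yes old = ⊥-elim (¬step λ _ → old)
      ...   | no ¬l  | no _    = ⊥-elim (¬step λ l → ⊥-elim (¬l l))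
      ...   | yes l  | no ¬old = u , l , ¬old

      grows-or-stable : ∀ k → suc k ≤ count (layer? k) ⊎ Stable k
      grows-or-stable zero = inj₁ (count-pos (layer? zero) (SameVertex-refl α))
      grows-or-stable (suc k) with grows-or-stable k
      ... | inj₂ stable = inj₂ (stable-suc stable)
      ... | inj₁ large with stable? k
      ...   | yes stable  = inj₂ (stable-suc stable)
      ...   | no unstable with new-element unstable
      ...     | _ , l , ¬old = inj₁ (ℕₚ.≤-trans (s≤s large) (count-mono-< (layer? k) (layer? (suc k)) inj₁ l ¬old))

      stable-at-n : Stable n
      stable-at-n with grows-or-stable n
      ... | inj₂ stable = stable
      ... | inj₁ large  = ⊥-elim (ℕₚ.<-irrefl refl (ℕₚ.≤-trans large (count-≤ (layer? n))))

    Reach⇒Layer : ∀ {u} → Reach α β x u → Layer n u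
    Reach⇒Layer here       = Layer-mono z≤n (SameVertex-refl α)
    Reach⇒Layer (stepα r)  = stable-at-n (inj₂ (_ , Reach⇒Layer r , inj₁ (1 , refl)))
    Reach⇒Layer (stepα⁻ r) = stable-at-n (inj₂ (_ , Reach⇒Layer r , inj₁ (SameVertex-sym α (1 , inverseʳ α))))
    Reach⇒Layer (stepβ r)  = stable-at-n (inj₂ (_ , Reach⇒Layer r , inj₂ (1 , refl)))
    Reach⇒Layer (stepβ⁻ r) = stable-at-n (inj₂ (_ , Reach⇒Layer r , inj₂ (SameVertex-sym β (1 , inverseʳ β))))

    reach? : ∀ y → Dec (Reach α β x y)
    reach? y = map′ (Layer⇒Reach n) Reach⇒Layer (layer? n y)

  components : DecEquivalence n
  components = record
    { _≈_              = Reach α β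
    ; isDecEquivalence = record
      { isEquivalence = record { refl = here ; sym = Reach-sym ; trans = Reach-trans }
      ; _≟_           = reach?
      }
    }

  #components : ℕ
  #components = #classes components

SameVertex-·⇒Reach : ∀ {n} (α β : Perm n) {u v} → SameVertex (α · β) u v → Reach α β u v
SameVertex-·⇒Reach α β {u} (k , refl) = go k
  where
    go : ∀ k → Reach α β u (iter (α · β) k u)
    go zero    = here
    go (suc k) = stepα (stepβ (go k))

-- Shortest walks and cycles

-- Recursive rather than 2 * t, so that double (suc t) reduces to suc (suc (double t)).
double : ℕ → ℕ
double zero    = zero
double (suc t) = suc (suc (double t))

double-injective : ∀ {a b} → double a ≡ double b → a ≡ b
double-injective {zero}  {zero}  _  = refl
double-injective {suc a} {suc b} eq = cong suc (double-injective (ℕₚ.suc-injective (ℕₚ.suc-injective eq)))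

odd≢double : ∀ a b → suc (double a) ≢ double b
odd≢double a       (suc b) eq = odd≢double b a (sym (ℕₚ.suc-injective eq))

double-mono-≤ : ∀ {a b} → a ≤ b → double a ≤ double b
double-mono-≤ z≤n       = z≤n
double-mono-≤ (s≤s a≤b) = s≤s (s≤s (double-mono-≤ a≤b))

even-or-odd : ∀ m → ∃ λ t → m ≡ double t ⊎ m ≡ suc (double t)
even-or-odd zero = zero , inj₁ refl
even-or-odd (suc m) with even-or-odd m
... | t , inj₁ refl = t , inj₂ refl
... | t , inj₂ refl = suc t , inj₁ refl

next-spec : ∀ {k} (i : Fin (suc k)) → (toℕ i ≡ k × next i ≡ zero) ⊎ (∃ λ j → next i ≡ suc j × toℕ j ≡ toℕ i)
next-spec {zero}  zero    = inj₁ (refl , refl)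
next-spec {suc k} zero    = inj₂ (zero , refl , refl)
next-spec {suc k} (suc i) with next {k} i | next-spec {k} i
... | zero  | inj₁ (i≡k , _)        = inj₁ (cong suc i≡k , refl)
... | suc j | inj₂ (_ , refl , j≡i) = inj₂ (suc j , refl , cong suc j≡i)

_[_]≔_ : ∀ {A : Set} → (ℕ → A) → ℕ → A → ℕ → A
(p [ j ]≔ u) i with i ℕ.≟ j
... | yes _ = u
... | no  _ = p i

[]≔-updated : ∀ {A : Set} (p : ℕ → A) j u → (p [ j ]≔ u) j ≡ u
[]≔-updated p j u with j ℕ.≟ j
... | yes _  = refl
... | no j≢j = ⊥-elim (j≢j refl)

[]≔-other : ∀ {A : Set} (p : ℕ → A) {j} u {i} → i ≢ j → (p [ j ]≔ u) i ≡ p i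
[]≔-other p {j} u {i} i≢j with i ℕ.≟ j
... | yes i≡j = ⊥-elim (i≢j i≡j)
... | no _    = refl

module _ {n} (α β : Perm n) (x : Fin n) where

  ExactLayer : ℕ → Fin n → Set
  ExactLayer zero    u = Layer α β x zero u
  ExactLayer (suc j) u = Layer α β x (suc j) u × ¬ Layer α β x j u

  ExactLayer⇒Layer : ∀ j {u} → ExactLayer j u → Layer α β x j u
  ExactLayer⇒Layer zero    l       = l
  ExactLayer⇒Layer (suc j) (l , _) = l

  ExactLayer-new : ∀ {i j u} → i < j → ExactLayer j u → ¬ Layer α β x i u
  ExactLayer-new {j = suc j} (s≤s i≤j) (_ , ¬l) l = ¬l (Layer-mono α β x i≤j l)

  ExactLayer-frontier : ∀ j {v u} → Layer α β x j v → Adjacent α β v u → ¬ Layer α β x j u → ExactLayer j v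
  ExactLayer-frontier zero    l v∼u ¬l = l
  ExactLayer-frontier (suc j) l v∼u ¬l = l , λ l′ → ¬l (inj₂ (_ , l′ , v∼u))

  record Geodesic (j : ℕ) (u : Fin n) : Set where
    field
      node  : ℕ → Fin n
      end   : node j ≡ u
      exact : ∀ {i} → i ≤ j → ExactLayer i (node i)
      step  : ∀ {i} → i < j → Adjacent α β (node i) (node (suc i))

  geodesic : ∀ j {u} → ExactLayer j u → Geodesic j u
  geodesic zero    {u} l = record { node = λ _ → u ; end = refl ; exact = λ { z≤n → l } ; step = λ () }
  geodesic (suc j) (inj₁ l , ¬l)                  = ⊥-elim (¬l l)
  geodesic (suc j) {u} (inj₂ (v , l , v∼u) , ¬l) = record
    { node  = node [ suc j ]≔ u
    ; end   = []≔-updated node (suc j) u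
    ; exact = exact′
    ; step  = step′
    }
    where
      open Geodesic (geodesic j (ExactLayer-frontier j l v∼u ¬l))
      exact′ : ∀ {i} → i ≤ suc j → ExactLayer i ((node [ suc j ]≔ u) i)
      exact′ {i} i≤1+j with i ℕ.≟ suc j
      ... | yes refl = inj₂ (v , l , v∼u) , ¬l
      ... | no i≢1+j = exact (ℕₚ.≤-pred (ℕₚ.≤∧≢⇒< i≤1+j i≢1+j))
      step′ : ∀ {i} → i < suc j → Adjacent α β ((node [ suc j ]≔ u) i) ((node [ suc j ]≔ u) (suc i))
      step′ {i} i<1+j with i ℕ.≟ j
      ... | yes refl = subst₂ (Adjacent α β) (sym (trans ([]≔-other node u (ℕₚ.<⇒≢ i<1+j)) end))
                         (sym ([]≔-updated node (suc j) u)) v∼u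
      ... | no i≢j   = subst₂ (Adjacent α β) (sym ([]≔-other node u (ℕₚ.<⇒≢ i<1+j)))
                         (sym ([]≔-other node u (i≢j ∘ ℕₚ.suc-injective)))
                         (step (ℕₚ.≤∧≢⇒< (ℕₚ.≤-pred i<1+j) i≢j))

  module _ {j u} (g : Geodesic j u) where
    open Geodesic g

    geodesic-injective : ∀ {i i′} → i ≤ j → i′ ≤ j → node i ≡ node i′ → i ≡ i′
    geodesic-injective {i} {i′} i≤j i′≤j same with ℕₚ.<-cmp i i′
    ... | tri≈ _ i≡i′ _ = i≡i′
    ... | tri< i<i′ _ _ =
      ⊥-elim (ExactLayer-new i<i′ (exact i′≤j) (subst (Layer α β x i) same (ExactLayer⇒Layer i (exact i≤j))))
    ... | tri> _ _ i′<i =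
      ⊥-elim (ExactLayer-new i′<i (exact i≤j) (subst (Layer α β x i′) (sym same) (ExactLayer⇒Layer i′ (exact i′≤j))))

    private
      shortcut : ∀ i → suc (suc i) ≤ j → ¬ Adjacent α β (node i) (node (suc (suc i)))
      shortcut i i+2≤j adj =
        proj₂ (exact i+2≤j) (inj₂ (node i , ExactLayer⇒Layer i (exact i≤j) , adj))
        where
          i≤j : i ≤ j
          i≤j = ℕₚ.≤-trans (ℕₚ.n≤1+n i) (ℕₚ.≤-trans (ℕₚ.n≤1+n _) i+2≤j)

      first-step-black : 0 < j → SameVertex β (node 0) (node 1)
      first-step-black 0<j with step 0<j
      ... | inj₁ white = ⊥-elim (proj₂ (exact 0<j) (SameVertex-trans α (exact z≤n) white))
      ... | inj₂ black = black

    alternating : ∀ t → (double t < j → SameVertex β (node (double t)) (node (suc (double t)))) ×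
                        (suc (double t) < j → SameVertex α (node (suc (double t))) (node (double (suc t))))
    alternating t = black-step t , white-step t
      where
        black-step : ∀ t → double t < j → SameVertex β (node (double t)) (node (suc (double t)))
        white-step : ∀ t → suc (double t) < j → SameVertex α (node (suc (double t))) (node (double (suc t)))
        black-step zero    0<j = first-step-black 0<j
        black-step (suc t) lt with step lt
        ... | inj₁ white =
          ⊥-elim (shortcut (suc (double t)) lt (inj₁ (SameVertex-trans α (white-step t (ℕₚ.<-trans (ℕₚ.n<1+n _) lt)) white)))
        ... | inj₂ black = black
        white-step t lt with step lt
        ... | inj₁ white = white
        ... | inj₂ black =
          ⊥-elim (shortcut (double t) lt (inj₂ (SameVertex-trans β (black-step t (ℕₚ.<-trans (ℕₚ.n<1+n _) lt)) black)))

module _ {n} (α α′ β : Perm n) {x y : Fin n}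
         (α⊆α′ : ∀ {u v} → SameVertex α u v → SameVertex α′ u v) (y∼x : SameVertex α′ y x) where

  cycle-from-odd-geodesic : ∀ t {u} → Geodesic α β x (suc (double t)) u → SameVertex α y u → Cycle α′ β
  cycle-from-odd-geodesic t g y∼u = record
    { len   = t
    ; a     = node ∘ a-pos
    ; c     = node ∘ c-pos
    ; a-inj = λ i j → a-pos-injective i j ∘ geodesic-injective α β x g (a-pos≤k i) (a-pos≤k j)
    ; c-inj = λ i j → Finₚ.toℕ-injective ∘ double-injective ∘ geodesic-injective α β x g (c-pos≤k i) (c-pos≤k j)
    ; a≢c   = λ i j → a-pos≢c-pos i j ∘ geodesic-injective α β x g (a-pos≤k i) (c-pos≤k j)
    ; white = white
    ; black = black
    }
    where
      open Geodesic g

      a-pos c-pos : Fin (suc t) → ℕ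
      a-pos zero    = suc (double t)
      a-pos (suc j) = suc (double (toℕ j))
      c-pos j = double (toℕ j)

      odd<k : ∀ {j} → j < t → suc (double j) < suc (double t)
      odd<k j<t = s≤s (ℕₚ.<⇒≤ (double-mono-≤ j<t))

      even<k : ∀ (i : Fin (suc t)) → c-pos i < suc (double t)
      even<k i = s≤s (double-mono-≤ (ℕₚ.≤-pred (Finₚ.toℕ<n i)))

      a-pos≤k : ∀ i → a-pos i ≤ suc (double t)
      a-pos≤k zero    = ℕₚ.≤-refl
      a-pos≤k (suc j) = ℕₚ.<⇒≤ (odd<k (Finₚ.toℕ<n j))

      c-pos≤k : ∀ i → c-pos i ≤ suc (double t)
      c-pos≤k i = ℕₚ.<⇒≤ (even<k i)

      a-pos-injective : ∀ i j → a-pos i ≡ a-pos j → i ≡ j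
      a-pos-injective zero    zero    _  = refl
      a-pos-injective zero    (suc j) eq = ⊥-elim (ℕₚ.<⇒≢ (Finₚ.toℕ<n j) (sym (double-injective (ℕₚ.suc-injective eq))))
      a-pos-injective (suc i) zero    eq = ⊥-elim (ℕₚ.<⇒≢ (Finₚ.toℕ<n i) (double-injective (ℕₚ.suc-injective eq)))
      a-pos-injective (suc i) (suc j) eq = cong suc (Finₚ.toℕ-injective (double-injective (ℕₚ.suc-injective eq)))

      a-pos≢c-pos : ∀ i j → a-pos i ≢ c-pos j
      a-pos≢c-pos zero    j = odd≢double t (toℕ j)
      a-pos≢c-pos (suc i) j = odd≢double (toℕ i) (toℕ j)

      white : ∀ i → SameVertex α′ (node (a-pos i)) (node (c-pos i))
      white zero    = SameVertex-trans α′ (α⊆α′ (SameVertex-sym α (subst (SameVertex α y) (sym end) y∼u)))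
                        (SameVertex-trans α′ y∼x (α⊆α′ (exact z≤n)))
      white (suc j) = α⊆α′ (proj₂ (alternating α β x g (toℕ j)) (odd<k (Finₚ.toℕ<n j)))

      black : ∀ i → SameVertex β (node (c-pos i)) (node (a-pos (next i)))
      black i with next-spec i | proj₁ (alternating α β x g (toℕ i)) (even<k i)
      ... | inj₁ (i≡t , next≡0)      | b-step = subst (λ j → SameVertex β (node (c-pos i)) (node (a-pos j))) (sym next≡0)
                                                   (subst (λ m → SameVertex β (node (c-pos i)) (node (suc (double m)))) i≡t b-step)
      ... | inj₂ (j , next≡j , j≡i) | b-step = subst (λ j → SameVertex β (node (c-pos i)) (node (a-pos j))) (sym next≡j)
                                                   (subst (λ m → SameVertex β (node (c-pos i)) (node (suc (double m)))) (sym j≡i) b-step)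

  -- A shortest walk from the α-orbit of x to that of y alternates black and white vertices
  -- and has odd length; the chord y ∼′ x closes it up to a cycle.
  cycle-closing-chord : ¬ SameVertex α x y → Reach α β x y → Cycle α′ β
  cycle-closing-chord x≁y x⇝y with least-ℕ meets? (y , Reach⇒Layer α β x x⇝y , SameVertex-refl α)
    where
      meets? : Decidable λ j → ∃ λ u → Layer α β x j u × SameVertex α y u
      meets? j = Finₚ.any? λ u → layer? α β x j u ×-dec sameVertex? α y u
  ... | zero  , (u , l , y∼u) , _ = ⊥-elim (x≁y (SameVertex-trans α l (SameVertex-sym α y∼u)))
  ... | suc m , (u , l , y∼u) , shorter = by-parity (even-or-odd m)
    where
      g : Geodesic α β x (suc m) u
      g = geodesic α β x (suc m) (l , λ l′ → shorter ℕₚ.≤-refl (u , l′ , y∼u))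
      open Geodesic g
      by-parity : (∃ λ t → m ≡ double t ⊎ m ≡ suc (double t)) → Cycle α′ β
      by-parity (t , inj₁ refl) = cycle-from-odd-geodesic t g y∼u
      by-parity (t , inj₂ refl) = ⊥-elim (shorter ℕₚ.≤-refl (node m , ExactLayer⇒Layer α β x m (exact (ℕₚ.n≤1+n m)) ,
        SameVertex-trans α y∼u (SameVertex-sym α last-step-white)))
        where
          last-step-white : SameVertex α (node m) u
          last-step-white = subst (SameVertex α (node m)) end (proj₂ (alternating α β x g t) ℕₚ.≤-refl)

-- The Euler and forest inequalities

-- splitCycle α x fixes x and sends α⁻¹ x to α x, cutting x out of its α-cycle.
splitCycle : ∀ {n} → Perm n → Fin n → Perm n
splitCycle α x = transpose x (α ⟨$⟩ʳ x) · α

module _ {n} (α : Perm n) {x : Fin n} where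

  splitCycle-Transposed : Transposed x (α ⟨$⟩ʳ x) α (splitCycle α x)
  splitCycle-Transposed _ = refl

  z-splitCycle : α ⟨$⟩ʳ x ≢ x → z (splitCycle α x) ≡ suc (z α)
  z-splitCycle αx≢x = z-transpose-split α (splitCycle α x) (αx≢x ∘ sym) splitCycle-Transposed (1 , refl)

  splitCycle-separates : α ⟨$⟩ʳ x ≢ x → ¬ SameVertex (splitCycle α x) x (α ⟨$⟩ʳ x)
  splitCycle-separates αx≢x = transpose-separates α (splitCycle α x) (αx≢x ∘ sym) splitCycle-Transposed (1 , refl)

  SameVertex-splitCycle⇒SameVertex : ∀ {u v} → SameVertex (splitCycle α x) u v → SameVertex α u v
  SameVertex-splitCycle⇒SameVertex = Glued⇒≈ (orbits α) x _ (1 , refl) ∘ SameVertex-Transposed⇒Glued splitCycle-Transposed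

cycle-splitting-induction : ∀ {n} (P : Perm n → Set) →
  (∀ α → (∀ u → α ⟨$⟩ʳ u ≡ u) → P α) →
  (∀ α {x} → α ⟨$⟩ʳ x ≢ x → P (splitCycle α x) → P α) →
  ∀ α → P α
cycle-splitting-induction {n} P identity split =
  All.wfRec (On.wellFounded (λ α → n ∸ z α) <-wellFounded) _ P step
  where
    step : ∀ α → (∀ {α′} → n ∸ z α′ < n ∸ z α → P α′) → P α
    step α smaller with Finₚ.any? (λ u → ¬? (α ⟨$⟩ʳ u Fin.≟ u))
    ... | no none          = identity α λ u → decidable-stable (α ⟨$⟩ʳ u Fin.≟ u) (λ αu≢u → none (u , αu≢u))
    ... | yes (x , αx≢x) = split α αx≢x (smaller (subst (λ m → n ∸ m < n ∸ z α) (sym z-split)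
                                                     (ℕₚ.∸-monoʳ-< (ℕₚ.n<1+n (z α)) (subst (_≤ n) z-split (z-≤ _)))))
      where
        z-split : z (splitCycle α x) ≡ suc (z α)
        z-split = z-splitCycle α αx≢x

module _ {n} (α β : Perm n) {x : Fin n} where
  private
    α′ : Perm n
    α′ = splitCycle α x
    y : Fin n
    y = α ⟨$⟩ʳ x

  Reach-splitCycle⇒Reach : ∀ {u v} → Reach α′ β u v → Reach α β u v
  Reach-splitCycle⇒Reach = Reach-minimal α′ β (DecEquivalence.isEquivalence (components α β))
    (λ u → Reach-trans α β (stepα here)
             (Glued⇒≈ (components α β) x y (stepα here) (Glued-transpose x y (components α β) _)))
    (λ u → stepβ here)

  Reach⇒Glued : ∀ {u v} → Reach α β u v → Glued (components α′ β) x y u v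
  Reach⇒Glued = Reach-minimal α β (Glued-isEquivalence (components α′ β) x y)
    (λ u → subst (Glued (components α′ β) x y u) (sym (Transposed-sym α α′ (splitCycle-Transposed α) u))
             (Glued-trans (components α′ β) x y (inj₁ (stepα here)) (Glued-transpose x y (components α′ β) _)))
    (λ u → inj₁ (stepβ here))

  #components-splitCycle : ¬ Reach α′ β x y → #components α′ β ≡ suc (#components α β)
  #components-splitCycle unreachable =
    #classes-glue (components α′ β) (components α β) Reach-splitCycle⇒Reach Reach⇒Glued unreachable (stepα here)

  #components-splitCycle-reach : Reach α′ β x y → #components α′ β ≡ #components α β
  #components-splitCycle-reach =
    #classes-glue-redundant (components α′ β) (components α β) Reach-splitCycle⇒Reach Reach⇒Glued

module _ {n} (α β : Perm n) (α-fixes : ∀ u → α ⟨$⟩ʳ u ≡ u) where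

  z-identity : z α ≡ n
  z-identity = trans (z≡#classes-orbits α) (#classes-discrete (orbits α) λ { (k , refl) → sym (iter-fixes k) })
    where
      iter-fixes : ∀ k {u} → iter α k u ≡ u
      iter-fixes zero    = refl
      iter-fixes (suc k) = trans (cong (α ⟨$⟩ʳ_) (iter-fixes k)) (α-fixes _)

  z-identity-· : z (α · β) ≡ z β
  z-identity-· = z-cong (α · β) β (λ u → α-fixes _)

  #components-identity : #components α β ≡ z β
  #components-identity =
    trans (#classes-cong (components α β) (orbits β) Reach⇒SameVertex (SameVertex⇒Reachβ α β))
          (sym (z≡#classes-orbits β))
    where
      Reach⇒SameVertex : ∀ {u v} → Reach α β u v → SameVertex β u v
      Reach⇒SameVertex = Reach-minimal α β (DecEquivalence.isEquivalence (orbits β))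
                           (λ u → 0 , sym (α-fixes u)) (λ u → 1 , refl)

euler-inequality : ∀ {n} (α β : Perm n) → z α + z β + z (α · β) ≤ n + (#components α β + #components α β)
euler-inequality {n} α β = cycle-splitting-induction Euler identity split α
  where
    Euler : Perm n → Set
    Euler α = z α + z β + z (α · β) ≤ n + (#components α β + #components α β)

    identity : ∀ α → (∀ u → α ⟨$⟩ʳ u ≡ u) → Euler α
    identity α α-fixes = ℕₚ.≤-reflexive (begin
      z α + z β + z (α · β)                   ≡⟨ cong₂ (λ a b → a + z β + b) (z-identity α β α-fixes)
                                                                            (z-identity-· α β α-fixes) ⟩
      n + z β + z β                           ≡⟨ ℕₚ.+-assoc n (z β) (z β) ⟩
      n + (z β + z β)                         ≡⟨ cong (λ c → n + (c + c)) (#components-identity α β α-fixes) ⟨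
      n + (#components α β + #components α β) ∎)
      where open ≡-Reasoning

    split : ∀ α {x} → α ⟨$⟩ʳ x ≢ x → Euler (splitCycle α x) → Euler α
    split α {x} αx≢x euler′ = by-reachability (reach? α′ β x (α ⟨$⟩ʳ x))
      where
        α′ : Perm n
        α′ = splitCycle α x
        c c′ : ℕ
        c  = #components α β
        c′ = #components α′ β
        αβ≗τα′β : Transposed x (α ⟨$⟩ʳ x) (α′ · β) (α · β)
        αβ≗τα′β u = Transposed-sym α α′ (splitCycle-Transposed α) (β ⟨$⟩ʳ u)
        open ℕₚ.≤-Reasoning

        by-reachability : Dec (Reach α′ β x (α ⟨$⟩ʳ x)) → Euler α
        by-reachability (yes reach) = begin
          z α + z β + z (α · β)        ≤⟨ ℕₚ.+-monoʳ-≤ (z α + z β) (z-transpose-≤ (α′ · β) (α · β) (αx≢x ∘ sym) αβ≗τα′β) ⟩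
          z α + z β + suc (z (α′ · β)) ≡⟨ ℕₚ.+-suc (z α + z β) _ ⟩
          suc (z α) + z β + z (α′ · β) ≡⟨ cong (λ a → a + z β + z (α′ · β)) (z-splitCycle α αx≢x) ⟨
          z α′ + z β + z (α′ · β)      ≤⟨ euler′ ⟩
          n + (c′ + c′)                ≡⟨ cong (λ c → n + (c + c)) (#components-splitCycle-reach α β reach) ⟩
          n + (c + c)                  ∎
        by-reachability (no unreachable) = ℕₚ.≤-pred (ℕₚ.≤-pred (begin
          suc (suc (z α + z β + z (α · β))) ≡⟨ ℕₚ.+-suc (suc (z α) + z β) _ ⟨
          suc (z α) + z β + suc (z (α · β)) ≡⟨ cong₂ (λ a b → a + z β + b) (z-splitCycle α αx≢x) merged ⟨
          z α′ + z β + z (α′ · β)           ≤⟨ euler′ ⟩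
          n + (c′ + c′)                     ≡⟨ cong (λ c → n + (c + c)) (#components-splitCycle α β unreachable) ⟩
          n + (suc c + suc c)               ≡⟨ cong (λ m → n + suc m) (ℕₚ.+-suc c c) ⟩
          n + suc (suc (c + c))             ≡⟨ trans (ℕₚ.+-suc n _) (cong suc (ℕₚ.+-suc n _)) ⟩
          suc (suc (n + (c + c)))           ∎))
          where
            merged : z (α′ · β) ≡ suc (z (α · β))
            merged = z-transpose-merge (α′ · β) (α · β) (αx≢x ∘ sym) αβ≗τα′β (unreachable ∘ SameVertex-·⇒Reach α′ β)

Cycle-mono : ∀ {n} {α α′ β : Perm n} → (∀ {u v} → SameVertex α u v → SameVertex α′ u v) → Cycle α β → Cycle α′ β
Cycle-mono α⊆α′ cyc = record
  { len = len ; a = a ; c = c ; a-inj = a-inj ; c-inj = c-inj ; a≢c = a≢c ; white = α⊆α′ ∘ white ; black = black }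
  where open Cycle cyc

forest-inequality : ∀ {n} (α β : Perm n) → ¬ Cycle α β → n + #components α β ≤ z α + z β
forest-inequality {n} α β = cycle-splitting-induction Forest identity split α
  where
    Forest : Perm n → Set
    Forest α = ¬ Cycle α β → n + #components α β ≤ z α + z β

    identity : ∀ α → (∀ u → α ⟨$⟩ʳ u ≡ u) → Forest α
    identity α α-fixes _ = ℕₚ.≤-reflexive (cong₂ _+_ (sym (z-identity α β α-fixes)) (#components-identity α β α-fixes))

    split : ∀ α {x} → α ⟨$⟩ʳ x ≢ x → Forest (splitCycle α x) → Forest α
    split α {x} αx≢x forest′ acyclic = by-reachability (reach? α′ β x (α ⟨$⟩ʳ x))
      where
        α′ : Perm n
        α′ = splitCycle α x
        open ℕₚ.≤-Reasoning

        by-reachability : Dec (Reach α′ β x (α ⟨$⟩ʳ x)) → n + #components α β ≤ z α + z β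
        by-reachability (yes reach) = ⊥-elim (acyclic (cycle-closing-chord α′ α β (SameVertex-splitCycle⇒SameVertex α)
          (SameVertex-sym α (1 , refl)) (splitCycle-separates α αx≢x) reach))
        by-reachability (no unreachable) = ℕₚ.≤-pred (begin
          suc (n + #components α β)  ≡⟨ ℕₚ.+-suc n _ ⟨
          n + suc (#components α β)  ≡⟨ cong (n +_) (#components-splitCycle α β unreachable) ⟨
          n + #components α′ β       ≤⟨ forest′ (acyclic ∘ Cycle-mono (SameVertex-splitCycle⇒SameVertex α)) ⟩
          z α′ + z β                 ≡⟨ cong (_+ z β) (z-splitCycle α αx≢x) ⟩
          suc (z α + z β)            ∎)

#components-transitive : ∀ {n} (α β : Perm n) → Fin n → Transitive α β → #components α β ≡ 1
#components-transitive α β = #classes≡1 (components α β)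

one-face⇒Transitive : ∀ {n} (α β : Perm n) → z (α · β) ≡ 1 → Transitive α β
one-face⇒Transitive α β one-face u v = SameVertex-·⇒Reach α β
  (#classes≡1⇒total (orbits (α · β)) (trans (sym (z≡#classes-orbits (α · β))) one-face) u v)

mainTheorem5 : ∀ {n : ℕ} (σw σb : Perm n) → TreeDessinPair σw σb →
    ∀ (s : Perm n) → Transitive (σw ^ s) σb ⇔ (z ((σw ^ s) · σb) ≡ 1)
mainTheorem5 {n} σw σb (transitive , _ , (e , _) , acyclic) s = mk⇔ one-face (one-face⇒Transitive w σb)
  where
    w : Perm n
    w = σw ^ s
    open ℕₚ.≤-Reasoning

    one-face : Transitive w σb → z (w · σb) ≡ 1
    one-face transitive′ = ℕₚ.≤-antisym (ℕₚ.+-cancelˡ-≤ (n + 1) _ _ (begin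
      n + 1 + z (w · σb)                ≡⟨ cong (λ c → n + c + z (w · σb)) (#components-transitive σw σb e transitive) ⟨
      n + #components σw σb + z (w · σb) ≤⟨ ℕₚ.+-monoˡ-≤ _ (forest-inequality σw σb acyclic) ⟩
      z σw + z σb + z (w · σb)          ≡⟨ cong (λ a → a + z σb + z (w · σb)) (z-^ σw s) ⟨
      z w + z σb + z (w · σb)           ≤⟨ euler-inequality w σb ⟩
      n + (c + c)                       ≡⟨ cong (λ c → n + (c + c)) (#components-transitive w σb e transitive′) ⟩
      n + (1 + 1)                       ≡⟨ ℕₚ.+-assoc n 1 1 ⟨
      n + 1 + 1                         ∎)) (z-pos (w · σb) e)
      where
        c : ℕ
        c = #components w σb
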